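{- For all $n,m$: there exists a 3-graph of order $n$ and size $m$ containing exactly one pair of distinct edges that intersect in two points if and only if there exists a 2-$(n,3,1)$ packing of size $m-2$ whose leave contains $K_4-e$ as a subgraph.
   Context: A 3-graph is a pair $(X,\mathcal{A})$ with $X$ a finite vertex set and $\mathcal{A}$ a set of 3-subsets of $X$ (edges); order $=|X|$, size $=|\mathcal{A}|$. A 2-$(n,3,1)$ packing is a 3-graph of order $n$ in which every 2-subset lies in at most one edge (block); its leave is the graph on the vertex set whose edges are the 2-subsets contained in no block. $K_4-e$ is $K_4$ minus one edge. -}

module Defs where

open import Data.Nat using (ℕ; _+_)
open import Data.Fin using (Fin)
open import Data.Fin.Subset using (Subset; ∣_∣; _∩_; _∈_)
open import Data.List using (List; length)
open import Data.List.Relation.Unary.All using (All)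
open import Data.List.Relation.Unary.Unique.Propositional using (Unique)
import Data.List.Membership.Propositional as LM
open import Data.Product using (Σ; ∃; ∃-syntax; _×_; _,_)
open import Data.Sum using (_⊎_)
open import Relation.Binary.PropositionalEquality using (_≡_; _≢_)

-- A 3-graph on vertex set Fin n (so its order is n): a finite SET of
-- 3-subsets of Fin n, given as a duplicate-free list of subsets of size 3.
record ThreeGraph (n : ℕ) : Set where
  field
    edges   : List (Subset n)
    unique  : Unique edges
    size3   : All (λ e → ∣ e ∣ ≡ 3) edges

open ThreeGraph public

size : ∀ {n} → ThreeGraph n → ℕ
size G = length (edges G)

_∈E_ : ∀ {n} → Subset n → ThreeGraph n → Set
e ∈E G = e LM.∈ edges G

MeetInTwo : ∀ {n} → ThreeGraph n → Subset n → Subset n → Set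
MeetInTwo G A B = A ∈E G × B ∈E G × A ≢ B × ∣ A ∩ B ∣ ≡ 2

ExactlyOneTwoIntersectingPair : ∀ {n} → ThreeGraph n → Set
ExactlyOneTwoIntersectingPair G =
  ∃[ A ] ∃[ B ] (MeetInTwo G A B ×
    (∀ C D → MeetInTwo G C D → (C ≡ A × D ≡ B) ⊎ (C ≡ B × D ≡ A)))

IsPacking : ∀ {n} → ThreeGraph n → Set
IsPacking {n} G = ∀ (x y : Fin n) → x ≢ y → ∀ A B →
  A ∈E G → B ∈E G → x ∈ A → y ∈ A → x ∈ B → y ∈ B → A ≡ B

InLeave : ∀ {n} → ThreeGraph n → Fin n → Fin n → Set
InLeave G x y = x ≢ y × (∀ A → A ∈E G → x ∈ A → y ∈ A → Data.Empty.⊥)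
  where import Data.Empty

-- the leave contains K4 - e as a subgraph: four distinct vertices a,b,c,d
-- with all pairs except {c,d} in the leave
LeaveContainsK4e : ∀ {n} → ThreeGraph n → Set
LeaveContainsK4e {n} G = Σ (Fin n) λ a → Σ (Fin n) λ b → Σ (Fin n) λ c → Σ (Fin n) λ d →
  c ≢ d ×
  InLeave G a b × InLeave G a c × InLeave G a d ×
  InLeave G b c × InLeave G b d

module Submission where

-- Forward: if A, B are the unique two edges meeting in {x, y}, write A =
-- {x, y, c} and B = {x, y, d}.  Deleting A and B leaves a packing, since
-- any further pair of blocks sharing two points would be a second such
-- pair; for the same reason no remaining block covers a pair inside A or
-- B, so x, y, c, d span a K₄ - e (missing cd) in the leave.
-- Backward: if a, b, c, d span K₄ - e in the leave, adding the triangles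
-- {a, b, c} and {a, b, d} creates exactly one pair of edges meeting in
-- two points, because every pair inside either triangle is in the leave.

open import Defs
open import Data.Nat using (ℕ; suc; _+_; _≤_; _<_; z≤n; s≤s)
open import Data.Nat.Properties
  using (≤-trans; ≤-reflexive; ≤-antisym; ≤-pred; <-irrefl; <⇒≱; ≤-<-trans;
         +-comm; +-suc; +-monoʳ-≤; +-mono-≤)
open import Data.Bool using (true; false)
import Data.Bool.Properties as Bool
open import Data.Fin using (Fin)
open import Data.Fin.Properties using (any?)
open import Data.Fin.Subset
  using (Subset; ∣_∣; _∩_; _∪_; _∈_; _∉_; _⊆_; _⊈_; _-_; ⁅_⁆; ⊥)
open import Data.Fin.Subset.Properties
  using (_∈?_; _⊆?_; x∈p∩q⁺; x∈p∩q⁻; x∈p∪q⁺; x∈p∪q⁻; x∈⁅x⁆; x∈⁅y⁆⇒x≡y; ∣⁅x⁆∣≡1;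
         ∣⊥∣≡0; ∣p∣≤∣x∷p∣; p⊆q⇒∣p∣≤∣q∣; p⊂q⇒∣p∣<∣q∣; ⊆-antisym; x∈p⇒∣p-x∣<∣p∣;
         x∈p∧x≢y⇒x∈p-y)
open import Data.Vec using ([]; _∷_)
open import Data.Vec.Properties using (≡-dec)
open import Data.List using (List; _∷_; _++_; length)
open import Data.List.Relation.Unary.All as All using (All; _∷_)
open import Data.List.Relation.Unary.AllPairs as AllPairs using (_∷_)
open import Data.List.Relation.Unary.Any using (here; there)
open import Data.List.Relation.Unary.Unique.Propositional using (Unique)
import Data.List.Membership.Propositional as LM
open import Data.List.Membership.Propositional.Properties using (∈-∃++)
open import Data.List.Relation.Binary.Permutation.Propositional
  using (_↭_; ↭⇒↭ₛ; prep; ↭-trans; ↭-sym)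
open import Data.List.Relation.Binary.Permutation.Propositional.Properties
  using (shift; ∈-resp-↭; All-resp-↭; ↭-length)
import Data.List.Relation.Binary.Permutation.Setoid.Properties as Permₛ
open import Data.Product using (Σ; _×_; _,_; proj₁; proj₂; ∃; ∃₂)
open import Data.Sum using (_⊎_; inj₁; inj₂)
open import Function using (_∘_)
open import Function.Bundles using (_⇔_; mk⇔)
open import Relation.Nullary using (¬_; yes; no; ¬?; contradiction)
open import Relation.Nullary.Decidable using (_×-dec_; decidable-stable)
open import Relation.Binary.PropositionalEquality
  using (_≡_; _≢_; refl; sym; trans; subst; setoid)

private
  variable
    n : ℕ
    p q : Subset n
    x y z : Fin n

-- A point of p outside q can be found whenever p ⊈ q: membership is
-- decidable and Fin n is finite.
⊈⇒∃∉ : p ⊈ q → ∃ λ x → x ∈ p × x ∉ q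
⊈⇒∃∉ {p = p} {q} p⊈q with any? (λ x → x ∈? p ×-dec ¬? (x ∈? q))
... | yes witness = witness
... | no none = contradiction
  (λ {x} x∈p → decidable-stable (x ∈? q) (λ x∉q → none (x , x∈p , x∉q))) p⊈q

larger⇒⊈ : ∣ q ∣ < ∣ p ∣ → p ⊈ q
larger⇒⊈ q<p p⊆q = <⇒≱ q<p (p⊆q⇒∣p∣≤∣q∣ p⊆q)

1≤∣∣⇒point : 1 ≤ ∣ p ∣ → ∃ λ x → x ∈ p
1≤∣∣⇒point {n} {p} 1≤∣p∣ with ⊈⇒∃∉ (larger⇒⊈ {q = ⊥} (subst (_< ∣ p ∣) (sym (∣⊥∣≡0 n)) 1≤∣p∣))
... | x , x∈p , _ = x , x∈p

2≤∣∣⇒two-points : 2 ≤ ∣ p ∣ → ∃₂ λ x y → x ≢ y × x ∈ p × y ∈ p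
2≤∣∣⇒two-points {p = p} 2≤∣p∣ with 1≤∣∣⇒point (≤-trans (s≤s z≤n) 2≤∣p∣)
... | x , x∈p with ⊈⇒∃∉ (larger⇒⊈ {q = ⁅ x ⁆} (subst (_< ∣ p ∣) (sym (∣⁅x⁆∣≡1 x)) 2≤∣p∣))
...   | y , y∈p , y∉⁅x⁆ = x , y , (λ x≡y → y∉⁅x⁆ (subst (_∈ ⁅ x ⁆) x≡y (x∈⁅x⁆ x))) , x∈p , y∈p

more-than-p-x : ∀ {k} → x ∈ p → k ≤ ∣ p - x ∣ → suc k ≤ ∣ p ∣
more-than-p-x x∈p k≤∣p-x∣ = ≤-<-trans k≤∣p-x∣ (x∈p⇒∣p-x∣<∣p∣ x∈p)

two-points⇒2≤∣∣ : x ≢ y → x ∈ p → y ∈ p → 2 ≤ ∣ p ∣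
two-points⇒2≤∣∣ x≢y x∈p y∈p =
  more-than-p-x x∈p (more-than-p-x (x∈p∧x≢y⇒x∈p-y y∈p (x≢y ∘ sym)) z≤n)

three-points⇒3≤∣∣ : x ≢ y → x ≢ z → y ≢ z → x ∈ p → y ∈ p → z ∈ p → 3 ≤ ∣ p ∣
three-points⇒3≤∣∣ x≢y x≢z y≢z x∈p y∈p z∈p =
  more-than-p-x x∈p
    (two-points⇒2≤∣∣ y≢z (x∈p∧x≢y⇒x∈p-y y∈p (x≢y ∘ sym)) (x∈p∧x≢y⇒x∈p-y z∈p (x≢z ∘ sym)))

∈∧∉⇒≢ : x ∈ p → y ∉ p → x ≢ y
∈∧∉⇒≢ {p = p} x∈p y∉p x≡y = y∉p (subst (_∈ p) x≡y x∈p)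

≢∧∣∣≡⇒⊈ : p ≢ q → ∣ p ∣ ≡ ∣ q ∣ → p ⊈ q
≢∧∣∣≡⇒⊈ {p = p} {q} p≢q ∣p∣≡∣q∣ p⊆q with q ⊆? p
... | yes q⊆p = p≢q (⊆-antisym p⊆q q⊆p)
... | no q⊈p = <-irrefl ∣p∣≡∣q∣ (p⊂q⇒∣p∣<∣q∣ (p⊆q , ⊈⇒∃∉ q⊈p))

-- Two distinct sets of the same size meet in fewer points than either
-- has: p ∩ q misses a point c of p, so it fits inside p - c.
∣p∩q∣<∣p∣ : p ≢ q → ∣ p ∣ ≡ ∣ q ∣ → ∣ p ∩ q ∣ < ∣ p ∣
∣p∩q∣<∣p∣ {p = p} {q} p≢q ∣p∣≡∣q∣ with ⊈⇒∃∉ (≢∧∣∣≡⇒⊈ p≢q ∣p∣≡∣q∣)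
... | c , c∈p , c∉q = ≤-<-trans (p⊆q⇒∣p∣≤∣q∣ p∩q⊆p-c) (x∈p⇒∣p-x∣<∣p∣ c∈p)
  where
  p∩q⊆p-c : p ∩ q ⊆ p - c
  p∩q⊆p-c x∈p∩q with x∈p∩q⁻ p q x∈p∩q
  ... | x∈p , x∈q = x∈p∧x≢y⇒x∈p-y x∈p (λ x≡c → c∉q (subst (_∈ q) x≡c x∈q))

∣p∪q∣≤∣p∣+∣q∣ : ∀ (p q : Subset n) → ∣ p ∪ q ∣ ≤ ∣ p ∣ + ∣ q ∣
∣p∪q∣≤∣p∣+∣q∣ [] [] = z≤n
∣p∪q∣≤∣p∣+∣q∣ (true ∷ p) (s ∷ q) =
  s≤s (≤-trans (∣p∪q∣≤∣p∣+∣q∣ p q) (+-monoʳ-≤ ∣ p ∣ (∣p∣≤∣x∷p∣ s q)))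
∣p∪q∣≤∣p∣+∣q∣ (false ∷ p) (true ∷ q) =
  ≤-trans (s≤s (∣p∪q∣≤∣p∣+∣q∣ p q)) (≤-reflexive (sym (+-suc ∣ p ∣ ∣ q ∣)))
∣p∪q∣≤∣p∣+∣q∣ (false ∷ p) (false ∷ q) = ∣p∪q∣≤∣p∣+∣q∣ p q

triangle : Fin n → Fin n → Fin n → Subset n
triangle a b c = ⁅ a ⁆ ∪ ⁅ b ⁆ ∪ ⁅ c ⁆

module _ {a b c : Fin n} where

  ∈-triangle₁ : a ∈ triangle a b c
  ∈-triangle₁ = x∈p∪q⁺ (inj₁ (x∈⁅x⁆ a))

  ∈-triangle₂ : b ∈ triangle a b c
  ∈-triangle₂ = x∈p∪q⁺ (inj₂ (x∈p∪q⁺ (inj₁ (x∈⁅x⁆ b))))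

  ∈-triangle₃ : c ∈ triangle a b c
  ∈-triangle₃ = x∈p∪q⁺ (inj₂ (x∈p∪q⁺ (inj₂ (x∈⁅x⁆ c))))

  ∈-triangle⁻ : x ∈ triangle a b c → x ≡ a ⊎ x ≡ b ⊎ x ≡ c
  ∈-triangle⁻ x∈abc with x∈p∪q⁻ ⁅ a ⁆ _ x∈abc
  ... | inj₁ x∈a = inj₁ (x∈⁅y⁆⇒x≡y a x∈a)
  ... | inj₂ x∈bc with x∈p∪q⁻ ⁅ b ⁆ ⁅ c ⁆ x∈bc
  ...   | inj₁ x∈b = inj₂ (inj₁ (x∈⁅y⁆⇒x≡y b x∈b))
  ...   | inj₂ x∈c = inj₂ (inj₂ (x∈⁅y⁆⇒x≡y c x∈c))

  -- Three distinct corners give a 3-set: at most 1 + 1 + 1 points by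
  -- subadditivity, at least three since the corners are distinct.
  ∣triangle∣≡3 : a ≢ b → a ≢ c → b ≢ c → ∣ triangle a b c ∣ ≡ 3
  ∣triangle∣≡3 a≢b a≢c b≢c = ≤-antisym at-most-3
    (three-points⇒3≤∣∣ a≢b a≢c b≢c ∈-triangle₁ ∈-triangle₂ ∈-triangle₃)
    where
    ∣⁅_⁆∣≤1 : ∀ x → ∣ ⁅ x ⁆ ∣ ≤ 1
    ∣⁅ x ⁆∣≤1 = ≤-reflexive (∣⁅x⁆∣≡1 x)
    at-most-3 : ∣ triangle a b c ∣ ≤ 3
    at-most-3 = ≤-trans (∣p∪q∣≤∣p∣+∣q∣ ⁅ a ⁆ _) (+-mono-≤ ∣⁅ a ⁆∣≤1
      (≤-trans (∣p∪q∣≤∣p∣+∣q∣ ⁅ b ⁆ ⁅ c ⁆) (+-mono-≤ ∣⁅ b ⁆∣≤1 ∣⁅ c ⁆∣≤1)))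

SharePair : Subset n → Subset n → Set
SharePair E F = ∃₂ λ u v → u ≢ v × u ∈ E × v ∈ E × u ∈ F × v ∈ F

SharePair-sym : ∀ {E F : Subset n} → SharePair E F → SharePair F E
SharePair-sym (u , v , u≢v , u∈E , v∈E , u∈F , v∈F) = u , v , u≢v , u∈F , v∈F , u∈E , v∈E

meetInTwo⇒SharePair : ∀ {E F : Subset n} → ∣ E ∩ F ∣ ≡ 2 → SharePair E F
meetInTwo⇒SharePair {E = E} {F} ∣E∩F∣≡2
  with 2≤∣∣⇒two-points (≤-reflexive (sym ∣E∩F∣≡2))
... | u , v , u≢v , u∈E∩F , v∈E∩F with x∈p∩q⁻ E F u∈E∩F | x∈p∩q⁻ E F v∈E∩F
...   | u∈E , u∈F | v∈E , v∈F = u , v , u≢v , u∈E , v∈E , u∈F , v∈F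

-- Conversely, two distinct 3-sets sharing a pair meet in exactly two
-- points: at least the pair, and fewer than three as they differ.
SharePair⇒meetInTwo : ∀ {E F : Subset n} → ∣ E ∣ ≡ 3 → ∣ F ∣ ≡ 3 → E ≢ F →
  SharePair E F → ∣ E ∩ F ∣ ≡ 2
SharePair⇒meetInTwo {E = E} {F} ∣E∣≡3 ∣F∣≡3 E≢F (u , v , u≢v , u∈E , v∈E , u∈F , v∈F) = ≤-antisym
  (≤-pred (subst (∣ E ∩ F ∣ <_) ∣E∣≡3 (∣p∩q∣<∣p∣ E≢F (trans ∣E∣≡3 (sym ∣F∣≡3)))))
  (two-points⇒2≤∣∣ u≢v (x∈p∩q⁺ (u∈E , u∈F)) (x∈p∩q⁺ (v∈E , v∈F)))

module _ {a} {A : Set a} where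

  Unique-resp-↭ : ∀ {xs ys : List A} → xs ↭ ys → Unique xs → Unique ys
  Unique-resp-↭ π = Permₛ.AllPairs-resp-↭ (setoid A) (_∘ sym)
    ((λ { refl x≢y → x≢y }) , (λ { refl x≢y → x≢y })) (↭⇒↭ₛ π)

  extract : ∀ {x : A} {xs} → x LM.∈ xs → ∃ λ ys → xs ↭ x ∷ ys
  extract x∈xs with ys , zs , refl ← ∈-∃++ x∈xs = ys ++ zs , shift _ ys zs

  extract₂ : ∀ {x y : A} {xs} → x LM.∈ xs → y LM.∈ xs → x ≢ y → ∃ λ zs → xs ↭ x ∷ y ∷ zs
  extract₂ x∈xs y∈xs x≢y with ys , π ← extract x∈xs with ∈-resp-↭ π y∈xs
  ... | here y≡x = contradiction (sym y≡x) x≢y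
  ... | there y∈ys with zs , ρ ← extract y∈ys = zs , ↭-trans π (prep _ ρ)

edge-size : ∀ (G : ThreeGraph n) {E} → E ∈E G → ∣ E ∣ ≡ 3
edge-size G E∈G = All.lookup (size3 G) E∈G

module DeletingThePair {n} (G : ThreeGraph n) {A B : Subset n}
  (A∈G : A ∈E G) (B∈G : B ∈E G) (A≢B : A ≢ B)
  (only : ∀ C D → MeetInTwo G C D → (C ≡ A × D ≡ B) ⊎ (C ≡ B × D ≡ A)) where

  split : ∃ λ rest → edges G ↭ A ∷ B ∷ rest
  split = extract₂ A∈G B∈G A≢B

  rest : List (Subset n)
  rest = proj₁ split

  unique-A∷B∷rest : Unique (A ∷ B ∷ rest)
  unique-A∷B∷rest = Unique-resp-↭ (proj₂ split) (unique G)

  P : ThreeGraph n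
  P = record
    { edges  = rest
    ; unique = AllPairs.tail (AllPairs.tail unique-A∷B∷rest)
    ; size3  = All.tail (All.tail (All-resp-↭ (proj₂ split) (size3 G)))
    }

  size-P : size P + 2 ≡ size G
  size-P = trans (+-comm (length rest) 2) (sym (↭-length (proj₂ split)))

  block∈G : ∀ {E} → E ∈E P → E ∈E G
  block∈G E∈P = ∈-resp-↭ (↭-sym (proj₂ split)) (there (there E∈P))

  block≢A : ∀ {E} → E ∈E P → E ≢ A
  block≢A E∈P E≡A = All.lookup (AllPairs.head unique-A∷B∷rest) (there E∈P) (sym E≡A)

  block≢B : ∀ {E} → E ∈E P → E ≢ B
  block≢B E∈P E≡B =
    All.lookup (AllPairs.head (AllPairs.tail unique-A∷B∷rest)) E∈P (sym E≡B)

  -- A block of P shares no pair with another edge of G: the two would be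
  -- a pair of edges meeting in two points other than {A, B}.
  block-shares-no-pair : ∀ {E F} → E ∈E P → F ∈E G → E ≢ F → ¬ SharePair E F
  block-shares-no-pair {E} {F} E∈P F∈G E≢F shared
    with only E F (block∈G E∈P , F∈G , E≢F ,
                   SharePair⇒meetInTwo (edge-size G (block∈G E∈P)) (edge-size G F∈G)
                     E≢F shared)
  ... | inj₁ (E≡A , _) = block≢A E∈P E≡A
  ... | inj₂ (E≡B , _) = block≢B E∈P E≡B

  packing : IsPacking P
  packing u v u≢v E F E∈P F∈P u∈E v∈E u∈F v∈F with ≡-dec Bool._≟_ E F
  ... | yes E≡F = E≡F
  ... | no E≢F = contradiction (u , v , u≢v , u∈E , v∈E , u∈F , v∈F)
                   (block-shares-no-pair E∈P (block∈G F∈P) E≢F)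

  in-leave : ∀ {F u v} → F ∈E G → (∀ {E} → E ∈E P → E ≢ F) →
    u ≢ v → u ∈ F → v ∈ F → InLeave P u v
  in-leave {u = u} {v} F∈G F∉P u≢v u∈F v∈F = u≢v , λ E E∈P u∈E v∈E →
    block-shares-no-pair E∈P F∈G (F∉P E∈P) (u , v , u≢v , u∈E , v∈E , u∈F , v∈F)

  same-size : ∣ A ∣ ≡ ∣ B ∣
  same-size = trans (edge-size G A∈G) (sym (edge-size G B∈G))

  -- With A ∩ B = {x, y}, c ∈ A - B and d ∈ B - A, the leave contains every
  -- pair of x, y, c, d except cd.
  leave-contains-K4e : ∣ A ∩ B ∣ ≡ 2 → LeaveContainsK4e P
  leave-contains-K4e ∣A∩B∣≡2
    with meetInTwo⇒SharePair ∣A∩B∣≡2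
       | ⊈⇒∃∉ (≢∧∣∣≡⇒⊈ A≢B same-size)
       | ⊈⇒∃∉ (≢∧∣∣≡⇒⊈ (A≢B ∘ sym) (sym same-size))
  ... | x , y , x≢y , x∈A , y∈A , x∈B , y∈B | c , c∈A , c∉B | d , d∈B , d∉A =
    x , y , c , d , ∈∧∉⇒≢ c∈A d∉A ,
    in-A x≢y x∈A y∈A , in-A (∈∧∉⇒≢ x∈B c∉B) x∈A c∈A , in-B (∈∧∉⇒≢ x∈A d∉A) x∈B d∈B ,
    in-A (∈∧∉⇒≢ y∈B c∉B) y∈A c∈A , in-B (∈∧∉⇒≢ y∈A d∉A) y∈B d∈B
    where
    in-A : ∀ {u v} → u ≢ v → u ∈ A → v ∈ A → InLeave P u v
    in-A = in-leave A∈G block≢A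
    in-B : ∀ {u v} → u ≢ v → u ∈ B → v ∈ B → InLeave P u v
    in-B = in-leave B∈G block≢B

forward : ∀ {n m} →
  (Σ (ThreeGraph n) λ G → size G ≡ m × ExactlyOneTwoIntersectingPair G) →
  (Σ (ThreeGraph n) λ P → size P + 2 ≡ m × IsPacking P × LeaveContainsK4e P)
forward (G , size-G , A , B , (A∈G , B∈G , A≢B , ∣A∩B∣≡2) , only) =
  P , trans size-P size-G , packing , leave-contains-K4e ∣A∩B∣≡2
  where open DeletingThePair G A∈G B∈G A≢B only

module _ (G : ThreeGraph n) where

  InLeave-sym : InLeave G x y → InLeave G y x
  InLeave-sym (x≢y , uncovered) = x≢y ∘ sym , λ E E∈G y∈E x∈E → uncovered E E∈G x∈E y∈E

  triangle-in-leave : ∀ {a b c u v : Fin n} →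
    InLeave G a b → InLeave G a c → InLeave G b c →
    u ≢ v → u ∈ triangle a b c → v ∈ triangle a b c → InLeave G u v
  triangle-in-leave ab ac bc u≢v u∈abc v∈abc with ∈-triangle⁻ u∈abc | ∈-triangle⁻ v∈abc
  ... | inj₁ refl        | inj₁ refl        = contradiction refl u≢v
  ... | inj₁ refl        | inj₂ (inj₁ refl) = ab
  ... | inj₁ refl        | inj₂ (inj₂ refl) = ac
  ... | inj₂ (inj₁ refl) | inj₁ refl        = InLeave-sym ab
  ... | inj₂ (inj₁ refl) | inj₂ (inj₁ refl) = contradiction refl u≢v
  ... | inj₂ (inj₁ refl) | inj₂ (inj₂ refl) = bc
  ... | inj₂ (inj₂ refl) | inj₁ refl        = InLeave-sym ac
  ... | inj₂ (inj₂ refl) | inj₂ (inj₁ refl) = InLeave-sym bc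
  ... | inj₂ (inj₂ refl) | inj₂ (inj₂ refl) = contradiction refl u≢v

  triangle-shares-no-pair : ∀ {a b c : Fin n} {E} →
    InLeave G a b → InLeave G a c → InLeave G b c → E ∈E G → ¬ SharePair (triangle a b c) E
  triangle-shares-no-pair ab ac bc E∈G (u , v , u≢v , u∈abc , v∈abc , u∈E , v∈E) =
    proj₂ (triangle-in-leave ab ac bc u≢v u∈abc v∈abc) _ E∈G u∈E v∈E

module AddingTwoTriangles {n} (P : ThreeGraph n) (packing : IsPacking P)
  {a b c d : Fin n} (c≢d : c ≢ d)
  (ab : InLeave P a b) (ac : InLeave P a c) (ad : InLeave P a d)
  (bc : InLeave P b c) (bd : InLeave P b d) where

  A B : Subset n
  A = triangle a b c
  B = triangle a b d

  ∣A∣≡3 : ∣ A ∣ ≡ 3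
  ∣A∣≡3 = ∣triangle∣≡3 (proj₁ ab) (proj₁ ac) (proj₁ bc)

  ∣B∣≡3 : ∣ B ∣ ≡ 3
  ∣B∣≡3 = ∣triangle∣≡3 (proj₁ ab) (proj₁ ad) (proj₁ bd)

  d∉A : d ∉ A
  d∉A d∈A with ∈-triangle⁻ d∈A
  ... | inj₁ d≡a        = proj₁ ad (sym d≡a)
  ... | inj₂ (inj₁ d≡b) = proj₁ bd (sym d≡b)
  ... | inj₂ (inj₂ d≡c) = c≢d (sym d≡c)

  A≢B : A ≢ B
  A≢B A≡B = d∉A (subst (d ∈_) (sym A≡B) ∈-triangle₃)

  -- Neither triangle is a block, as both contain the leave pair ab.
  triangle-ab-new : ∀ {e} → ¬ triangle a b e ∈E P
  triangle-ab-new abe∈P = proj₂ ab _ abe∈P ∈-triangle₁ ∈-triangle₂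

  new≢blocks : ∀ {F} → ¬ F ∈E P → All (F ≢_) (edges P)
  new≢blocks F∉P = All.tabulate λ { E∈P refl → F∉P E∈P }

  G : ThreeGraph n
  G = record
    { edges  = A ∷ B ∷ edges P
    ; unique = (A≢B ∷ new≢blocks triangle-ab-new) ∷ new≢blocks triangle-ab-new ∷ unique P
    ; size3  = ∣A∣≡3 ∷ ∣B∣≡3 ∷ size3 P
    }

  A-meets-B : MeetInTwo G A B
  A-meets-B = here refl , there (here refl) , A≢B ,
    SharePair⇒meetInTwo ∣A∣≡3 ∣B∣≡3 A≢B
      (a , b , proj₁ ab , ∈-triangle₁ , ∈-triangle₂ , ∈-triangle₁ , ∈-triangle₂)

  -- Two distinct edges of G sharing a pair are A and B: two blocks cannot
  -- (P is a packing) and a block and a triangle cannot (the triangles'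
  -- pairs are in the leave).
  which-pair : ∀ {C D} → C ∈E G → D ∈E G → C ≢ D → SharePair C D →
    (C ≡ A × D ≡ B) ⊎ (C ≡ B × D ≡ A)
  which-pair (here refl)         (here refl)         C≢D _ = contradiction refl C≢D
  which-pair (here C≡A)          (there (here D≡B))  _   _ = inj₁ (C≡A , D≡B)
  which-pair (there (here C≡B))  (here D≡A)          _   _ = inj₂ (C≡B , D≡A)
  which-pair (there (here refl)) (there (here refl)) C≢D _ = contradiction refl C≢D
  which-pair (here refl) (there (there D∈P)) _ shared =
    contradiction shared (triangle-shares-no-pair P ab ac bc D∈P)
  which-pair (there (here refl)) (there (there D∈P)) _ shared =
    contradiction shared (triangle-shares-no-pair P ab ad bd D∈P)
  which-pair (there (there C∈P)) (here refl) _ shared =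
    contradiction (SharePair-sym shared) (triangle-shares-no-pair P ab ac bc C∈P)
  which-pair (there (there C∈P)) (there (here refl)) _ shared =
    contradiction (SharePair-sym shared) (triangle-shares-no-pair P ab ad bd C∈P)
  which-pair {C} {D} (there (there C∈P)) (there (there D∈P)) C≢D
    (u , v , u≢v , u∈C , v∈C , u∈D , v∈D) =
    contradiction (packing u v u≢v C D C∈P D∈P u∈C v∈C u∈D v∈D) C≢D

  only-A-B : ∀ C D → MeetInTwo G C D → (C ≡ A × D ≡ B) ⊎ (C ≡ B × D ≡ A)
  only-A-B C D (C∈G , D∈G , C≢D , ∣C∩D∣≡2) =
    which-pair C∈G D∈G C≢D (meetInTwo⇒SharePair ∣C∩D∣≡2)

backward : ∀ {n m} →
  (Σ (ThreeGraph n) λ P → size P + 2 ≡ m × IsPacking P × LeaveContainsK4e P) →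
  (Σ (ThreeGraph n) λ G → size G ≡ m × ExactlyOneTwoIntersectingPair G)
backward (P , size-P , packing , a , b , c , d , c≢d , ab , ac , ad , bc , bd) =
  G , trans (+-comm 2 (size P)) size-P , A , B , A-meets-B , only-A-B
  where open AddingTwoTriangles P packing c≢d ab ac ad bc bd

lemma3p1 : (n m : ℕ) →
    (Σ (ThreeGraph n) λ G → size G ≡ m × ExactlyOneTwoIntersectingPair G)
    ⇔ (Σ (ThreeGraph n) λ P → size P + 2 ≡ m × IsPacking P × LeaveContainsK4e P)
lemma3p1 n m = mk⇔ forward backward
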